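{- Let $G=(V,E)$ be a graph with critical clique graph $\mathcal{C}=(\mathcal{K},E_{\mathcal{C}})$. If $K_1$ and $K_2$ are closed critical cliques of $G$, then $\{K_1,K_2\}\notin E_{\mathcal{C}}$.
   Context: All graphs are finite, undirected and simple. A critical clique of $G=(V,E)$ is a clique $K$ such that all vertices of $K$ have the same neighbors in $V\setminus K$, and $K$ is inclusion-maximal with this property. The critical cliques partition $V$; let $\mathcal{K}$ be the set of critical cliques. The critical clique graph $\mathcal{C}=(\mathcal{K},E_{\mathcal{C}})$ has $\{K_i,K_j\}\in E_{\mathcal{C}}$ iff every $u\in K_i$ is adjacent in $G$ to every $v\in K_j$. For a critical clique $K$, $\mathcal{N}(K)$ denotes the union of the critical cliques adjacent to $K$ in $\mathcal{C}$. A critical clique $K$ is closed if $\mathcal{N}(K)$ is a clique in $G$, and open otherwise. -}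

module Defs where

open import Data.Nat using (ℕ)
open import Data.Fin using (Fin)
open import Data.Product using (Σ; ∃; _×_)
open import Relation.Nullary using (¬_)
open import Relation.Binary.PropositionalEquality using (_≡_; _≢_)
open import Function.Bundles using (_⇔_)
open import Level using () renaming (suc to lsuc; zero to lzero)

record Graph (n : ℕ) : Set₁ where
  field
    Adj   : Fin n → Fin n → Set
    sym   : ∀ {u v} → Adj u v → Adj v u
    irrefl : ∀ {u} → ¬ Adj u u

open Graph public

VSet : ℕ → Set₁
VSet n = Fin n → Set

_⊆_ : ∀ {n} → VSet n → VSet n → Set
A ⊆ B = ∀ x → A x → B x

module _ {n : ℕ} (G : Graph n) where

  IsClique : VSet n → Set
  IsClique K = ∀ u v → K u → K v → u ≢ v → Adj G u v

  SameOutsideNbrs : VSet n → Set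
  SameOutsideNbrs K = ∀ u v w → K u → K v → ¬ K w → (Adj G u w ⇔ Adj G v w)

  -- a (nonempty) clique with equal outside neighbourhoods, inclusion-maximal
  -- with this property (critical cliques partition V, so they are nonempty)
  IsCriticalClique : VSet n → Set₁
  IsCriticalClique K =
    (∃ λ v → K v) × IsClique K × SameOutsideNbrs K ×
    (∀ (K' : VSet n) → IsClique K' → SameOutsideNbrs K' → K ⊆ K' → K' ⊆ K)

  CCEdge : VSet n → VSet n → Set
  CCEdge K₁ K₂ = ∀ u v → K₁ u → K₂ v → Adj G u v

  𝒩 : VSet n → Fin n → Set₁
  𝒩 K x = Σ (VSet n) λ K' → IsCriticalClique K' × CCEdge K K' × K' x

  IsClosed : VSet n → Set₁
  IsClosed K = ∀ u v → 𝒩 K u → 𝒩 K v → u ≢ v → Adj G u v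

module Submission where

-- Suppose the critical cliques K₁ and K₂ are adjacent and both closed. Take u ∈ K₁, v ∈ K₂
-- and a neighbour w of u outside K₁ ∪ K₂. The class of true twins of w is a critical clique,
-- and it is adjacent to K₁: all of K₁ sees w, and no member of K₁ is a twin of w, since
-- critical cliques are closed under true twins. So w and v both lie in 𝒩(K₁), and
-- closedness of K₁ makes them adjacent. By symmetry K₁ ∪ K₂ is a clique whose vertices have
-- the same outside neighbours, so maximality of K₁ forces K₂ ⊆ K₁, and a vertex of K₂ would
-- be adjacent to itself.
-- Maximality of a twin class needs decidable adjacency; as the goal is ⊥ this costs
-- nothing, since decidability of a relation on a finite set holds up to double negation.

open import Defs
open import Data.Nat using (ℕ; zero; suc)
open import Data.Fin using (Fin; zero; suc; _≟_)
open import Data.Empty using (⊥-elim)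
open import Data.Sum using (_⊎_; inj₁; inj₂)
open import Data.Product using (_,_)
open import Function.Base using (_∘_)
open import Function.Bundles using (_⇔_; mk⇔; Equivalence)
open import Function.Construct.Identity using (⇔-id)
open import Function.Construct.Symmetry using (⇔-sym)
open import Function.Construct.Composition using (_⇔-∘_)
open import Relation.Nullary using (¬_; yes; no)
open import Relation.Nullary.Decidable using (¬¬-excluded-middle)
open import Relation.Unary using (Pred; _∪_; ｛_｝)
open import Relation.Binary.Definitions using (Decidable)
open import Relation.Binary.PropositionalEquality as ≡ using (_≡_; _≢_; refl)

open Equivalence using (to; from)

¬¬-∀-Fin : ∀ {m p} {P : Pred (Fin m) p} → (∀ i → ¬ ¬ P i) → ¬ ¬ (∀ i → P i)
¬¬-∀-Fin {zero}  ¬¬P ¬∀P = ¬∀P (λ ())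
¬¬-∀-Fin {suc m} ¬¬P ¬∀P =
  ¬¬P zero λ P₀ → ¬¬-∀-Fin (λ i → ¬¬P (suc i)) λ P₊ →
    ¬∀P λ { zero → P₀ ; (suc i) → P₊ i }

¬¬-decidable : ∀ {m} (R : Fin m → Fin m → Set) → ¬ ¬ Decidable R
¬¬-decidable R = ¬¬-∀-Fin λ x → ¬¬-∀-Fin λ y → ¬¬-excluded-middle

module _ {n : ℕ} (G : Graph n) where

  private
    variable
      u v w x y z : Fin n
      K K₁ K₂ : VSet n

  N[_] : Fin n → VSet n
  N[ x ] z = z ≡ x ⊎ Adj G x z

  TrueTwins : Fin n → Fin n → Set
  TrueTwins x y = ∀ z → N[ x ] z ⇔ N[ y ] z

  twinClass : Fin n → VSet n
  twinClass w x = TrueTwins x w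

  N[]-≢ : N[ x ] z → z ≢ x → Adj G x z
  N[]-≢ (inj₁ z≡x) z≢x = ⊥-elim (z≢x z≡x)
  N[]-≢ (inj₂ xz)  _   = xz

  clique⇒N[] : IsClique G K → K x → K z → N[ x ] z
  clique⇒N[] {x = x} {z = z} cl Kx Kz with z ≟ x
  ... | yes z≡x = inj₁ z≡x
  ... | no  z≢x = inj₂ (cl x z Kx Kz (z≢x ∘ ≡.sym))

  trueTwins-refl : TrueTwins x x
  trueTwins-refl _ = ⇔-id _

  trueTwins-sym : TrueTwins x y → TrueTwins y x
  trueTwins-sym t z = ⇔-sym (t z)

  trueTwins-trans : TrueTwins x y → TrueTwins y z → TrueTwins x z
  trueTwins-trans t t′ z = t′ z ⇔-∘ t z

  trueTwins-adjacent : TrueTwins x y → x ≢ y → Adj G x y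
  trueTwins-adjacent {y = y} t x≢y = N[]-≢ (from (t y) (inj₁ refl)) (x≢y ∘ ≡.sym)

  trueTwins-outside : TrueTwins x y → z ≢ x → z ≢ y → Adj G x z ⇔ Adj G y z
  trueTwins-outside {z = z} t z≢x z≢y =
    mk⇔ (λ xz → N[]-≢ (to (t z) (inj₂ xz)) z≢y) (λ yz → N[]-≢ (from (t z) (inj₂ yz)) z≢x)

  twinClass-isClique : IsClique G (twinClass w)
  twinClass-isClique x y tx ty = trueTwins-adjacent (trueTwins-trans tx (trueTwins-sym ty))

  twinClass-sameOutsideNbrs : SameOutsideNbrs G (twinClass w)
  twinClass-sameOutsideNbrs x y z tx ty z∉ =
    trueTwins-outside (trueTwins-trans tx (trueTwins-sym ty))
      (λ { refl → z∉ tx }) (λ { refl → z∉ ty })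

  insertTwin-isClique : IsClique G K → K x → TrueTwins y x → IsClique G (K ∪ ｛ y ｝)
  insertTwin-isClique cl Kx t u v (inj₁ Ku)    (inj₁ Kv)    u≢v = cl u v Ku Kv u≢v
  insertTwin-isClique cl Kx t u v (inj₁ Ku)    (inj₂ refl)  u≢v =
    Graph.sym G (N[]-≢ (from (t u) (clique⇒N[] cl Kx Ku)) u≢v)
  insertTwin-isClique cl Kx t u v (inj₂ refl)  (inj₁ Kv)    u≢v =
    N[]-≢ (from (t v) (clique⇒N[] cl Kx Kv)) (u≢v ∘ ≡.sym)
  insertTwin-isClique cl Kx t u v (inj₂ refl)  (inj₂ refl)  u≢v = ⊥-elim (u≢v refl)

  insertTwin-sameOutsideNbrs : SameOutsideNbrs G K → K x → TrueTwins y x →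
                               SameOutsideNbrs G (K ∪ ｛ y ｝)
  insertTwin-sameOutsideNbrs {K = K} {x = x} {y = y} sm Kx t u v z Ku Kv z∉ =
    ⇔-sym (likeX v Kv) ⇔-∘ likeX u Ku
    where
    likeX : ∀ u → (K ∪ ｛ y ｝) u → Adj G u z ⇔ Adj G x z
    likeX u (inj₁ Ku)   = sm u x z Ku Kx (z∉ ∘ inj₁)
    likeX _ (inj₂ refl) =
      trueTwins-outside t (λ { refl → z∉ (inj₂ refl) }) (λ { refl → z∉ (inj₁ Kx) })

  criticalClique-twinClosed : IsCriticalClique G K → K x → TrueTwins y x → K y
  criticalClique-twinClosed {K = K} {y = y} (_ , cl , sm , maximal) Kx t =
    maximal (K ∪ ｛ y ｝) (insertTwin-isClique cl Kx t) (insertTwin-sameOutsideNbrs sm Kx t)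
      (λ _ → inj₁) y (inj₂ refl)

  CCEdge-sym : CCEdge G K₁ K₂ → CCEdge G K₂ K₁
  CCEdge-sym e u v K₂u K₁v = Graph.sym G (e v u K₁v K₂u)

  CCEdge⇒disjoint : CCEdge G K₁ K₂ → K₁ v → ¬ K₂ v
  CCEdge⇒disjoint e K₁v K₂v = Graph.irrefl G (e _ _ K₁v K₂v)

  union-isClique : IsClique G K₁ → IsClique G K₂ → CCEdge G K₁ K₂ → IsClique G (K₁ ∪ K₂)
  union-isClique cl₁ cl₂ e u v (inj₁ a) (inj₁ b) = cl₁ u v a b
  union-isClique cl₁ cl₂ e u v (inj₁ a) (inj₂ b) _ = e u v a b
  union-isClique cl₁ cl₂ e u v (inj₂ a) (inj₁ b) _ = CCEdge-sym e u v a b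
  union-isClique cl₁ cl₂ e u v (inj₂ a) (inj₂ b) = cl₂ u v a b

  union-sameOutsideNbrs : SameOutsideNbrs G K₁ → SameOutsideNbrs G K₂ →
    (∀ u v w → K₁ u → K₂ v → ¬ (K₁ ∪ K₂) w → Adj G u w ⇔ Adj G v w) →
    SameOutsideNbrs G (K₁ ∪ K₂)
  union-sameOutsideNbrs sm₁ sm₂ cross u v w (inj₁ a) (inj₁ b) w∉ = sm₁ u v w a b (w∉ ∘ inj₁)
  union-sameOutsideNbrs sm₁ sm₂ cross u v w (inj₁ a) (inj₂ b) w∉ = cross u v w a b w∉
  union-sameOutsideNbrs sm₁ sm₂ cross u v w (inj₂ a) (inj₁ b) w∉ = ⇔-sym (cross v u w b a w∉)
  union-sameOutsideNbrs sm₁ sm₂ cross u v w (inj₂ a) (inj₂ b) w∉ = sm₂ u v w a b (w∉ ∘ inj₂)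

  module _ (Adj? : Decidable (Adj G)) where

    sameOutsideNbrs-clique⇒N[]-⊆ : IsClique G K → SameOutsideNbrs G K → K x → K y →
                                   N[ x ] z → N[ y ] z
    sameOutsideNbrs-clique⇒N[]-⊆ {K = K} {x = x} {y = y} {z = z} cl sm Kx Ky x~z
      with Adj? y z | z ≟ y
    ... | yes yz | _       = inj₂ yz
    ... | no  _  | yes z≡y = inj₁ z≡y
    ... | no ¬yz | no  z≢y = ⊥-elim (¬yz (to (sm x y z Kx Ky z∉K) (N[]-≢ x~z z≢x)))
      where
      z∉K : ¬ K z
      z∉K Kz = ¬yz (cl y z Ky Kz (z≢y ∘ ≡.sym))
      z≢x : z ≢ x
      z≢x refl = z∉K Kx

    sameOutsideNbrs-clique⇒trueTwins : IsClique G K → SameOutsideNbrs G K → K x → K y →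
                                       TrueTwins x y
    sameOutsideNbrs-clique⇒trueTwins cl sm Kx Ky _ =
      mk⇔ (sameOutsideNbrs-clique⇒N[]-⊆ cl sm Kx Ky) (sameOutsideNbrs-clique⇒N[]-⊆ cl sm Ky Kx)

    twinClass-isCritical : ∀ w → IsCriticalClique G (twinClass w)
    twinClass-isCritical w =
      (w , trueTwins-refl) , twinClass-isClique , twinClass-sameOutsideNbrs ,
      λ K cl sm twinClass⊆K x Kx →
        sameOutsideNbrs-clique⇒trueTwins cl sm Kx (twinClass⊆K w trueTwins-refl)

    twinClass-adjacent : IsCriticalClique G K → K u → ¬ K w → Adj G u w →
                         CCEdge G K (twinClass w)
    twinClass-adjacent {u = u} {w = w} c@(_ , _ , sm , _) Ku w∉K uw u′ x Ku′ tx =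
      Graph.sym G (N[]-≢ (from (tx u′) (inj₂ (Graph.sym G (to (sm u u′ w Ku Ku′ w∉K) uw))))
                         (λ { refl → w∉K (criticalClique-twinClosed c Ku′ (trueTwins-sym tx)) }))

    closed-outsideNbr-transfer : IsCriticalClique G K₁ → IsClosed G K₁ → IsCriticalClique G K₂ →
      CCEdge G K₁ K₂ → K₁ u → K₂ v → ¬ K₁ w → ¬ K₂ w → Adj G u w → Adj G v w
    closed-outsideNbr-transfer {K₂ = K₂} {v = v} {w = w} c₁ closed c₂ e K₁u K₂v w∉K₁ w∉K₂ uw =
      Graph.sym G (closed w v
        (twinClass w , twinClass-isCritical w , twinClass-adjacent c₁ K₁u w∉K₁ uw , trueTwins-refl)
        (K₂ , c₂ , e , K₂v)
        (λ { refl → w∉K₂ K₂v }))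

    closedCriticalCliques-nonadjacent : IsCriticalClique G K₁ → IsCriticalClique G K₂ →
      IsClosed G K₁ → IsClosed G K₂ → ¬ CCEdge G K₁ K₂
    closedCriticalCliques-nonadjacent {K₁ = K₁} {K₂ = K₂}
      c₁@(_ , cl₁ , sm₁ , maximal₁) c₂@((v , K₂v) , cl₂ , sm₂ , _) closed₁ closed₂ e =
      CCEdge⇒disjoint e v∈K₁ K₂v
      where
      cross : ∀ u v w → K₁ u → K₂ v → ¬ (K₁ ∪ K₂) w → Adj G u w ⇔ Adj G v w
      cross u v w K₁u K₂v w∉ = mk⇔
        (closed-outsideNbr-transfer c₁ closed₁ c₂ e K₁u K₂v (w∉ ∘ inj₁) (w∉ ∘ inj₂))
        (closed-outsideNbr-transfer c₂ closed₂ c₁ (CCEdge-sym e) K₂v K₁u (w∉ ∘ inj₂) (w∉ ∘ inj₁))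
      v∈K₁ : K₁ v
      v∈K₁ = maximal₁ (K₁ ∪ K₂) (union-isClique cl₁ cl₂ e)
                (union-sameOutsideNbrs sm₁ sm₂ cross) (λ _ → inj₁) v (inj₂ K₂v)

proposition2 : ∀ (n : ℕ) (G : Graph n) (K₁ K₂ : VSet n) →
    IsCriticalClique G K₁ → IsCriticalClique G K₂ →
    IsClosed G K₁ → IsClosed G K₂ → ¬ CCEdge G K₁ K₂
proposition2 n G K₁ K₂ c₁ c₂ closed₁ closed₂ e =
  ¬¬-decidable (Adj G) λ Adj? →
    closedCriticalCliques-nonadjacent G Adj? c₁ c₂ closed₁ closed₂ e
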